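{- Let $x \geq 2$ be even, let $T$ be a modified row-sum matrix $\mathrm{MRSM}_{\mathbb{Z}_6}(S,t,x;\Sigma)$, and suppose some row of $T$ has all entries equal to $0$. Let $G[\Delta]$ be the subgraph of $G = K_{(6:x)}$ determined by that row. Then $G[\Delta] \cup \bigcup_{k=1}^{x} G_{i_k}[f_5]$ can be decomposed into a $2x$-cycle factor and a 1-factor.
   Context: For a group $\Gamma$, a subset $S \subseteq \Gamma$, integers $t \geq 1$, $x \geq 2$, and a $t$-list $\Sigma$ of elements of $\Gamma$, a modified row-sum matrix $\mathrm{MRSM}_\Gamma(S,t,x;\Sigma)$ is a $t \times x$ matrix with entries in $\Gamma$ whose $i$-th column is an ordering of some $t$-element subset $S_i \subseteq S$, and whose list of left-to-right row sums is $\Sigma$. $G = K_{(6:x)}$ is the complete equipartite graph with parts $G_0,\dots,G_{x-1}$, part $G_i$ having vertex set $\{(i,j): j \in \mathbb{Z}_6\}$. The columns of $T$ are associated with the consecutive pairs $(i_1,i_2),\dots,(i_x,i_1)$ of a fixed Hamilton cycle $(i_1,\dots,i_x)$ on the part indices. For a row $(d_1,\dots,d_x)$, $G[\Delta]$ is the subgraph of $G$ with edge set $\bigcup_{k=1}^x \{\{(i_k,j),(i_{k+1},j+d_k)\}: j \in \mathbb{Z}_6\}$ (with $i_{x+1}=i_1$). Let $f_5 = \{\{0,2\},\{1,4\},\{3,5\}\}$, a 1-factor of $K_6$ on $\{0,\dots,5\}$, and $G_i[f_5]$ the graph with edges $\{(i,a),(i,b)\}$ for $\{a,b\} \in f_5$.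 A $2x$-cycle factor is a spanning subgraph each of whose components is a $2x$-cycle; a 1-factor is a perfect matching. -}

module Defs where

open import Data.Nat using (ℕ; zero; suc; _+_; _*_; NonZero)
open import Data.Nat.DivMod using (_%_; m%n<n)
open import Data.Fin using (Fin; zero; suc; toℕ; fromℕ<)
open import Data.Fin.Subset using (Subset; _∈_)
open import Data.Bool using (Bool; true; false)
open import Data.Product using (_×_; _,_; ∃; ∃-syntax; proj₁; proj₂)
open import Data.Sum using (_⊎_; inj₁; inj₂)
open import Function.Definitions using (Injective)
open import Relation.Binary.PropositionalEquality using (_≡_)

modN : ∀ n .{{_ : NonZero n}} → ℕ → Fin n
modN n m = fromℕ< (m%n<n m n)

nextF : ∀ {n} → Fin n → Fin n
nextF {suc n} i = modN (suc n) (suc (toℕ i))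

Z6 : Set
Z6 = Fin 6

_+₆_ : Z6 → Z6 → Z6
a +₆ b = modN 6 (toℕ a + toℕ b)

rowSum : ∀ {n} → (Fin n → Z6) → Z6
rowSum {zero}  f = zero
rowSum {suc n} f = f zero +₆ rowSum (λ i → f (suc i))

-- Modified row-sum matrix MRSM_{ℤ₆}(S,t,x;Σ)
-- T r k = entry in row r, column k; Σ r = r-th prescribed row sum.

record IsMRSM (S : Subset 6) (t x : ℕ) (Σ : Fin t → Z6)
              (T : Fin t → Fin x → Z6) : Set where
  field
    -- column k is an ordering of a t-subset S_k of S
    col-⊆S   : ∀ r k → T r k ∈ S
    col-inj  : ∀ k → Injective _≡_ _≡_ (λ r → T r k)
    rowSums  : ∀ r → rowSum (T r) ≡ Σ r

-- The graph G[Δ] ∪ ⋃_k G_{i_k}[f₅] inside K_(6:x), vertices (i , j).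
-- Edges are labelled:
--   inj₁ (k , j) : the edge {(i_k , j) , (i_{k+1} , j + d_k)} of G[Δ]
--   inj₂ (i , p) : the p-th edge of f₅ inside part G_i

Vtx : ℕ → Set
Vtx x = Fin x × Z6

Lbl : ℕ → Set
Lbl x = (Fin x × Z6) ⊎ (Fin x × Fin 3)

f5 : Fin 3 → Z6 × Z6
f5 zero             = (zero , suc (suc zero))
f5 (suc zero)       = (suc zero , suc (suc (suc (suc zero))))
f5 (suc (suc zero)) = (suc (suc (suc zero)) , suc (suc (suc (suc (suc zero)))))

-- σ k = i_{k+1} : the Hamilton cycle (i_1,…,i_x) on part indices;
-- d = the row Δ = (d_1,…,d_x)
ends : ∀ {x} → (σ : Fin x → Fin x) → (d : Fin x → Z6) → Lbl x → Vtx x × Vtx x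
ends σ d (inj₁ (k , j)) = ((σ k , j) , (σ (nextF k) , j +₆ d k))
ends σ d (inj₂ (i , p)) = ((i , proj₁ (f5 p)) , (i , proj₂ (f5 p)))

Incident : ∀ {x} → (σ : Fin x → Fin x) → (d : Fin x → Z6) → Lbl x → Vtx x → Set
Incident σ d e v = v ≡ proj₁ (ends σ d e) ⊎ v ≡ proj₂ (ends σ d e)

Joins : ∀ {x} → (σ : Fin x → Fin x) → (d : Fin x → Z6) → Lbl x → Vtx x → Vtx x → Set
Joins σ d e u w = (proj₁ (ends σ d e) ≡ u × proj₂ (ends σ d e) ≡ w)
                ⊎ (proj₁ (ends σ d e) ≡ w × proj₂ (ends σ d e) ≡ u)

IsOneFactor : ∀ {x} → (σ : Fin x → Fin x) → (d : Fin x → Z6) →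
              (Lbl x → Bool) → Bool → Set
IsOneFactor {x} σ d col c =
  ∀ (v : Vtx x) → ∃[ e ] ((col e ≡ c × Incident σ d e v) ×
      (∀ e' → col e' ≡ c → Incident σ d e' v → e' ≡ e))

-- the edges with colour c form a spanning subgraph each of whose
-- components is an n-cycle: every vertex u lies on an n-cycle
-- (distinct vertices c₀…c_{n-1}, distinct edges ε_i joining c_i, c_{i+1 mod n})
-- and every colour-c edge at a vertex of that cycle is one of its edges
-- (so the cycle is the whole component of u).
IsCycleFactor : ∀ {x} → (σ : Fin x → Fin x) → (d : Fin x → Z6) →
                (Lbl x → Bool) → Bool → ℕ → Set
IsCycleFactor {x} σ d col c n =
  ∀ (u : Vtx x) → ∃[ cv ] ∃[ ce ]
     ( Injective _≡_ _≡_ cv × Injective _≡_ _≡_ ce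
     × (∃[ i ] cv i ≡ u)
     × (∀ (i : Fin n) → col (ce i) ≡ c × Joins σ d (ce i) (cv i) (cv (nextF i)))
     × (∀ e i → col e ≡ c → Incident σ d e (cv i) → ∃[ m ] e ≡ ce m) )

Decomposes : ∀ {x} → (σ : Fin x → Fin x) → (d : Fin x → Z6) → Set
Decomposes {x} σ d = ∃[ col ]
  (IsCycleFactor σ d col true (2 * x) × IsOneFactor σ d col false)

{-# OPTIONS --safe #-}
module Submission where

-- With Δ = 0, G[Δ] is the union of the six level cycles (i₁,j) … (i_x,j), j ∈ ℤ₆, and every
-- vertex also lies on one f₅-edge.  Call an edge a cycle edge if it is a level edge other than
-- the closing edge {(i_x,j),(i₁,j)}, or an f₅-edge inside G_{i₁} or G_{i_x}.  The remaining
-- edges (the six closing edges and the f₅-edges of G_{i₂},…,G_{i_{x-1}}) meet every vertex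
-- exactly once.  The cycle edges split into one 2x-cycle per {a,b} ∈ f₅: along level a from
-- i₁ to i_x, through the f₅-edge in G_{i_x}, back along level b, and through the f₅-edge
-- in G_{i₁}.

open import Defs
open import Data.Nat using (ℕ; suc; _≤_; _+_; _*_; _%_; z≤n; s≤s)
open import Data.Nat.Divisibility using (_∣_)
open import Data.Nat.DivMod using (m<n⇒m%n≡m; n%n≡0)
open import Data.Nat.Properties using (+-identityʳ; +-suc; *-identityʳ; *-zeroʳ; 1+n≰n)
open import Data.Fin using (Fin; zero; suc; toℕ; fromℕ; inject₁; opposite; punchOut; combine; remQuot)
open import Data.Fin.Properties
  using (toℕ-injective; toℕ-fromℕ<; toℕ<n; toℕ-fromℕ; toℕ-inject₁; toℕ-combine; remQuot-combine;
         combine-remQuot; inject₁-injective; fromℕ≢inject₁; opposite-involutive; punchOut-injective;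
         injective⇒≤; any?; _≟_)
open import Data.Fin.Patterns using (0F; 1F; 2F; 3F; 4F; 5F)
open import Data.Fin.Relation.Unary.Top using (View; view; ‵fromℕ; ‵inject₁; view-fromℕ; view-inject₁)
open import Data.Fin.Subset using (Subset)
open import Data.Bool using (Bool; true; false)
open import Data.Product using (_×_; _,_; ∃; proj₁; proj₂; uncurry)
open import Data.Sum using (_⊎_; inj₁; inj₂)
open import Data.Sum.Properties using (inj₁-injective; inj₂-injective)
open import Function using (_∘_)
open import Function.Definitions using (Injective)
open import Relation.Nullary using (¬_; yes; no; does; contradiction)
open import Relation.Nullary.Decidable using (¬?; _⊎-dec_; decidable-stable; dec-true; dec-false)
open import Relation.Unary using (Decidable)
open import Relation.Binary.PropositionalEquality
  using (_≡_; _≢_; refl; sym; trans; cong; cong₂; subst; module ≡-Reasoning)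

toℕ-nextF : ∀ {n} (i : Fin (suc n)) → toℕ (nextF i) ≡ suc (toℕ i) % suc n
toℕ-nextF i = toℕ-fromℕ< _

toℕ≡suc⇒nextF≡ : ∀ {n} {i j : Fin (suc n)} → toℕ j ≡ suc (toℕ i) → nextF i ≡ j
toℕ≡suc⇒nextF≡ {n} {i} {j} eq = toℕ-injective (begin
  toℕ (nextF i)       ≡⟨ toℕ-nextF i ⟩
  suc (toℕ i) % suc n ≡⟨ cong (_% suc n) eq ⟨
  toℕ j % suc n       ≡⟨ m<n⇒m%n≡m (toℕ<n j) ⟩
  toℕ j               ∎)
  where open ≡-Reasoning

suc-toℕ≡n⇒nextF≡zero : ∀ {n} {i : Fin (suc n)} → suc (toℕ i) ≡ suc n → nextF i ≡ zero
suc-toℕ≡n⇒nextF≡zero {n} {i} eq = toℕ-injective (begin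
  toℕ (nextF i)       ≡⟨ toℕ-nextF i ⟩
  suc (toℕ i) % suc n ≡⟨ cong (_% suc n) eq ⟩
  suc n % suc n       ≡⟨ n%n≡0 (suc n) ⟩
  0                   ∎)
  where open ≡-Reasoning

nextF-inject₁ : ∀ {n} (i : Fin n) → nextF (inject₁ i) ≡ suc i
nextF-inject₁ i = toℕ≡suc⇒nextF≡ (cong suc (sym (toℕ-inject₁ i)))

nextF-fromℕ : ∀ n → nextF (fromℕ n) ≡ zero
nextF-fromℕ n = suc-toℕ≡n⇒nextF≡zero (cong suc (toℕ-fromℕ n))

nextF-combine-inject₁ : ∀ {m n} (s : Fin (suc m)) (k : Fin n) →
                        nextF (combine s (inject₁ k)) ≡ combine s (suc k)
nextF-combine-inject₁ {n = n} s k = toℕ≡suc⇒nextF≡ (begin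
  toℕ (combine s (suc k))                ≡⟨ toℕ-combine s (suc k) ⟩
  suc n * toℕ s + suc (toℕ k)            ≡⟨ +-suc (suc n * toℕ s) (toℕ k) ⟩
  suc (suc n * toℕ s + toℕ k)            ≡⟨ cong (λ t → suc (suc n * toℕ s + t)) (toℕ-inject₁ k) ⟨
  suc (suc n * toℕ s + toℕ (inject₁ k))  ≡⟨ cong suc (toℕ-combine s (inject₁ k)) ⟨
  suc (toℕ (combine s (inject₁ k)))      ∎)
  where open ≡-Reasoning

nextF-combine-fromℕ : ∀ {n} (s : Fin 2) → nextF (combine s (fromℕ n)) ≡ combine (nextF s) zero
nextF-combine-fromℕ {n} 0F = toℕ≡suc⇒nextF≡ (begin
  toℕ (combine {2} 1F (zero {n}))       ≡⟨ toℕ-combine {2} 1F (zero {n}) ⟩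
  suc n * 1 + 0                         ≡⟨ +-identityʳ (suc n * 1) ⟩
  suc n * 1                             ≡⟨ *-identityʳ (suc n) ⟩
  suc n                                 ≡⟨ cong suc (toℕ-fromℕ n) ⟨
  suc (toℕ (fromℕ n))                   ≡⟨ cong (λ t → suc (t + toℕ (fromℕ n))) (*-zeroʳ (suc n)) ⟨
  suc (suc n * 0 + toℕ (fromℕ n))       ≡⟨ cong suc (toℕ-combine {2} 0F (fromℕ n)) ⟨
  suc (toℕ (combine {2} 0F (fromℕ n)))  ∎)
  where open ≡-Reasoning
nextF-combine-fromℕ {n} 1F = suc-toℕ≡n⇒nextF≡zero (begin
  suc (toℕ (combine {2} 1F (fromℕ n)))  ≡⟨ cong suc (toℕ-combine {2} 1F (fromℕ n)) ⟩
  suc (suc n * 1 + toℕ (fromℕ n))       ≡⟨ cong₂ (λ a b → suc (a + b)) (*-identityʳ (suc n))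
                                                                        (toℕ-fromℕ n) ⟩
  suc (suc n + n)                       ≡⟨ cong (λ t → suc (suc n + t)) (+-identityʳ n) ⟨
  suc (suc n + (n + 0))                 ≡⟨ cong suc (+-suc n (n + 0)) ⟨
  2 * suc n                             ∎)
  where open ≡-Reasoning

opposite-fromℕ : ∀ n → opposite (fromℕ n) ≡ zero
opposite-fromℕ 0       = refl
opposite-fromℕ (suc n) = cong inject₁ (opposite-fromℕ n)

opposite-inject₁ : ∀ {n} (i : Fin n) → opposite (inject₁ i) ≡ suc (opposite i)
opposite-inject₁ zero    = refl
opposite-inject₁ (suc i) = cong inject₁ (opposite-inject₁ i)

injective⇒surjective : ∀ {n} {f : Fin n → Fin n} → Injective _≡_ _≡_ f →
                       ∀ v → ∃ λ k → f k ≡ v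
injective⇒surjective {suc n} {f} f-injective v with any? (λ k → f k ≟ v)
... | yes hit  = hit
... | no  miss = contradiction (injective⇒≤ g-injective) 1+n≰n
  where
  f≢v : ∀ k → f k ≢ v
  f≢v k eq = miss (k , eq)
  g : Fin (suc n) → Fin n
  g k = punchOut (f≢v k ∘ sym)
  g-injective : Injective _≡_ _≡_ g
  g-injective eq = f-injective (punchOut-injective (f≢v _ ∘ sym) (f≢v _ ∘ sym) eq)

+₆-identityʳ : ∀ j → j +₆ zero ≡ j
+₆-identityʳ j = toℕ-injective (begin
  toℕ (j +₆ zero)      ≡⟨ toℕ-fromℕ< _ ⟩
  (toℕ j + 0) % 6      ≡⟨ cong (_% 6) (+-identityʳ (toℕ j)) ⟩
  toℕ j % 6            ≡⟨ m<n⇒m%n≡m (toℕ<n j) ⟩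
  toℕ j                ∎)
  where open ≡-Reasoning

column : ∀ {m} → Fin 2 → Fin m → Fin m
column 0F k = k
column 1F k = opposite k

column-involutive : ∀ {m} s (k : Fin m) → column s (column s k) ≡ k
column-involutive 0F k = refl
column-involutive 1F k = opposite-involutive k

column-injective : ∀ {m} s {k k′ : Fin m} → column s k ≡ column s k′ → k ≡ k′
column-injective s {k} {k′} eq = begin
  k                         ≡⟨ column-involutive s k ⟨
  column s (column s k)     ≡⟨ cong (column s) eq ⟩
  column s (column s k′)    ≡⟨ column-involutive s k′ ⟩
  k′                        ∎
  where open ≡-Reasoning

column-fromℕ-injective : ∀ {m} {s s′ : Fin 2} →
                         column s (fromℕ (suc m)) ≡ column s′ (fromℕ (suc m)) → s ≡ s′
column-fromℕ-injective {s = 0F} {0F} _  = refl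
column-fromℕ-injective {s = 0F} {1F} eq = contradiction (trans eq (opposite-fromℕ _)) λ ()
column-fromℕ-injective {s = 1F} {0F} eq = contradiction (trans (sym eq) (opposite-fromℕ _)) λ ()
column-fromℕ-injective {s = 1F} {1F} _  = refl

stepAt : ∀ {m} {k : Fin (suc m)} → Fin 2 → View k → Fin 2 × Fin (suc m)
stepAt s ‵fromℕ       = nextF s , zero
stepAt s (‵inject₁ k) = s , suc k

step : ∀ {m} → Fin 2 × Fin (suc m) → Fin 2 × Fin (suc m)
step (s , k) = stepAt s (view k)

combine₂ : ∀ {m} → Fin 2 × Fin m → Fin (2 * m)
combine₂ = uncurry combine

remQuot₂ : ∀ m → Fin (2 * m) → Fin 2 × Fin m
remQuot₂ m = remQuot m

remQuot₂-combine₂ : ∀ {m} (c : Fin 2 × Fin m) → remQuot₂ m (combine₂ c) ≡ c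
remQuot₂-combine₂ (s , k) = remQuot-combine s k

combine₂-remQuot₂ : ∀ m (i : Fin (2 * m)) → combine₂ (remQuot₂ m i) ≡ i
combine₂-remQuot₂ m = combine-remQuot {2} m

remQuot₂-injective : ∀ m {i i′ : Fin (2 * m)} → remQuot₂ m i ≡ remQuot₂ m i′ → i ≡ i′
remQuot₂-injective m {i} {i′} eq = begin
  i                         ≡⟨ combine₂-remQuot₂ m i ⟨
  combine₂ (remQuot₂ m i)   ≡⟨ cong combine₂ eq ⟩
  combine₂ (remQuot₂ m i′)  ≡⟨ combine₂-remQuot₂ m i′ ⟩
  i′                        ∎
  where open ≡-Reasoning

nextF-combine₂ : ∀ {m} (c : Fin 2 × Fin (suc m)) → nextF (combine₂ c) ≡ combine₂ (step c)
nextF-combine₂ (s , k) = go (view k)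
  where
  go : ∀ {k} (v : View k) → nextF (combine s k) ≡ combine₂ (stepAt s v)
  go ‵fromℕ       = nextF-combine-fromℕ s
  go (‵inject₁ k) = nextF-combine-inject₁ s k

remQuot₂-nextF : ∀ m (i : Fin (2 * suc m)) → remQuot₂ (suc m) (nextF i) ≡ step (remQuot₂ (suc m) i)
remQuot₂-nextF m i = begin
  remQuot₂ (suc m) (nextF i)             ≡⟨ cong (remQuot₂ (suc m) ∘ nextF) (combine₂-remQuot₂ (suc m) i) ⟨
  remQuot₂ (suc m) (nextF (combine₂ c))  ≡⟨ cong (remQuot₂ (suc m)) (nextF-combine₂ c) ⟩
  remQuot₂ (suc m) (combine₂ (step c))   ≡⟨ remQuot₂-combine₂ (step c) ⟩
  step c                                 ∎
  where
  open ≡-Reasoning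
  c : Fin 2 × Fin (suc m)
  c = remQuot₂ (suc m) i

f5-end : Fin 3 → Fin 2 → Z6
f5-end p 0F = proj₁ (f5 p)
f5-end p 1F = proj₂ (f5 p)

f5⁻¹ : Z6 → Fin 3 × Fin 2
f5⁻¹ 0F = 0F , 0F
f5⁻¹ 1F = 1F , 0F
f5⁻¹ 2F = 0F , 1F
f5⁻¹ 3F = 2F , 0F
f5⁻¹ 4F = 1F , 1F
f5⁻¹ 5F = 2F , 1F

f5⁻¹-end : ∀ p s → f5⁻¹ (f5-end p s) ≡ (p , s)
f5⁻¹-end 0F 0F = refl
f5⁻¹-end 0F 1F = refl
f5⁻¹-end 1F 0F = refl
f5⁻¹-end 1F 1F = refl
f5⁻¹-end 2F 0F = refl
f5⁻¹-end 2F 1F = refl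

f5-end-f5⁻¹ : ∀ j → uncurry f5-end (f5⁻¹ j) ≡ j
f5-end-f5⁻¹ 0F = refl
f5-end-f5⁻¹ 1F = refl
f5-end-f5⁻¹ 2F = refl
f5-end-f5⁻¹ 3F = refl
f5-end-f5⁻¹ 4F = refl
f5-end-f5⁻¹ 5F = refl

f5-end-injective : ∀ {p q s t} → f5-end p s ≡ f5-end q t → (p , s) ≡ (q , t)
f5-end-injective {p} {q} {s} {t} eq = begin
  (p , s)            ≡⟨ f5⁻¹-end p s ⟨
  f5⁻¹ (f5-end p s)  ≡⟨ cong f5⁻¹ eq ⟩
  f5⁻¹ (f5-end q t)  ≡⟨ f5⁻¹-end q t ⟩
  (q , t)            ∎
  where open ≡-Reasoning

f5-end-injectiveʳ : ∀ p {s t} → f5-end p s ≡ f5-end p t → s ≡ t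
f5-end-injectiveʳ p {s} {t} eq = cong proj₂ (f5-end-injective {p} {p} {s} {t} eq)

pairOf : Z6 → Fin 3
pairOf j = proj₁ (f5⁻¹ j)

module ZeroRow {n : ℕ} (σ : Fin (2 + n) → Fin (2 + n)) (σ-injective : Injective _≡_ _≡_ σ)
               (d : Fin (2 + n) → Z6) (d≡0 : ∀ k → d k ≡ zero) where

  last : Fin (2 + n)
  last = fromℕ (suc n)

  Corner : Fin (2 + n) → Set
  Corner i = i ≡ σ zero ⊎ i ≡ σ last

  corner? : Decidable Corner
  corner? i = i ≟ σ zero ⊎-dec i ≟ σ last

  CycleEdge : Lbl (2 + n) → Set
  CycleEdge (inj₁ (k , _)) = k ≢ last
  CycleEdge (inj₂ (i , _)) = Corner i

  cycleEdge? : Decidable CycleEdge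
  cycleEdge? (inj₁ (k , _)) = ¬? (k ≟ last)
  cycleEdge? (inj₂ (i , _)) = corner? i

  colour : Lbl (2 + n) → Bool
  colour e = does (cycleEdge? e)

  colour-true : ∀ e → colour e ≡ true → CycleEdge e
  colour-true e _  with cycleEdge? e
  colour-true e _  | yes c = c
  colour-true e () | no _

  colour-false : ∀ e → colour e ≡ false → ¬ CycleEdge e
  colour-false e _  with cycleEdge? e
  colour-false e () | yes _
  colour-false e _  | no ¬c = ¬c

  +₆-d-identityʳ : ∀ k j → j +₆ d k ≡ j
  +₆-d-identityʳ k j = trans (cong (j +₆_) (d≡0 k)) (+₆-identityʳ j)

  incident-column : ∀ k j′ {v j} → Incident σ d (inj₁ (k , j′)) (v , j) →
                    j ≡ j′ × (v ≡ σ k ⊎ v ≡ σ (nextF k))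
  incident-column k j′ (inj₁ refl) = refl , inj₁ refl
  incident-column k j′ (inj₂ eq)   =
    trans (cong proj₂ eq) (+₆-d-identityʳ k j′) , inj₂ (cong proj₁ eq)

  incident-f5 : ∀ i q {v j} → Incident σ d (inj₂ (i , q)) (v , j) → v ≡ i × pairOf j ≡ q
  incident-f5 i q (inj₁ refl) = refl , cong proj₁ (f5⁻¹-end q 0F)
  incident-f5 i q (inj₂ refl) = refl , cong proj₁ (f5⁻¹-end q 1F)

  f5-incident : ∀ i q s → Incident σ d (inj₂ (i , q)) (i , f5-end q s)
  f5-incident i q 0F = inj₁ refl
  f5-incident i q 1F = inj₂ refl

  closing-edge-incident : ∀ {v} j → Corner v → Incident σ d (inj₁ (last , j)) (v , j)
  closing-edge-incident j (inj₂ refl) = inj₁ refl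
  closing-edge-incident j (inj₁ refl) =
    inj₂ (cong₂ _,_ (cong σ (sym (nextF-fromℕ (suc n)))) (sym (+₆-d-identityʳ last j)))

  closing-edge-corner : ∀ j′ {v j} → Incident σ d (inj₁ (last , j′)) (v , j) → Corner v
  closing-edge-corner j′ inc with proj₂ (incident-column last j′ inc)
  ... | inj₁ v≡σlast = inj₂ v≡σlast
  ... | inj₂ v≡σnext = inj₁ (trans v≡σnext (cong σ (nextF-fromℕ (suc n))))

  non-cycle-column≡last : ∀ k j → colour (inj₁ (k , j)) ≡ false → k ≡ last
  non-cycle-column≡last k j eq = decidable-stable (k ≟ last) (colour-false (inj₁ (k , j)) eq)

  oneFactor : IsOneFactor σ d colour false
  oneFactor (v , j) with corner? v
  ... | yes corner = inj₁ (last , j) , (closing , closing-edge-incident j corner) , unique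
    where
    closing : colour (inj₁ (last , j)) ≡ false
    closing = dec-false (cycleEdge? (inj₁ (last , j))) (λ last≢last → last≢last refl)
    unique : ∀ e → colour e ≡ false → Incident σ d e (v , j) → e ≡ inj₁ (last , j)
    unique (inj₁ (k , j′)) c inc =
      cong₂ (λ k j → inj₁ (k , j)) (non-cycle-column≡last k j′ c)
                                   (sym (proj₁ (incident-column k j′ inc)))
    unique (inj₂ (i , q)) c inc =
      contradiction (subst Corner (proj₁ (incident-f5 i q inc)) corner) (colour-false (inj₂ (i , q)) c)
  ... | no ¬corner = inj₂ (v , pairOf j) , (dec-false (corner? v) ¬corner , incident) , unique
    where
    incident : Incident σ d (inj₂ (v , pairOf j)) (v , j)
    incident = subst (Incident σ d (inj₂ (v , pairOf j)) ∘ (v ,_)) (f5-end-f5⁻¹ j)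
                     (f5-incident v (pairOf j) (proj₂ (f5⁻¹ j)))
    unique : ∀ e → colour e ≡ false → Incident σ d e (v , j) → e ≡ inj₂ (v , pairOf j)
    unique (inj₁ (k , j′)) c inc with refl ← non-cycle-column≡last k j′ c =
      contradiction (closing-edge-corner j′ inc) ¬corner
    unique (inj₂ (i , q)) c inc with refl , refl ← incident-f5 i q inc = refl

  -- The 2x-cycle through the levels of the f₅-pair p.  Position (s , k) is its k-th vertex
  -- on level f5-end p s, counted backwards on level 1 (hence column); combine₂ numbers the
  -- positions in cycle order.
  module Cycle (p : Fin 3) where

    vertex : Fin 2 × Fin (2 + n) → Vtx (2 + n)
    vertex (s , k) = σ (column s k) , f5-end p s

    edgeAt : ∀ {k : Fin (2 + n)} → Fin 2 → View k → Lbl (2 + n)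
    edgeAt s ‵fromℕ       = inj₂ (σ (column s last) , p)
    edgeAt s (‵inject₁ k) = inj₁ (inject₁ (column s k) , f5-end p s)

    edge : Fin 2 × Fin (2 + n) → Lbl (2 + n)
    edge (s , k) = edgeAt s (view k)

    edge-last : ∀ s → edge (s , last) ≡ inj₂ (σ (column s last) , p)
    edge-last s = cong (edgeAt s) (view-fromℕ (suc n))

    edge-inject₁ : ∀ s k → edge (s , inject₁ k) ≡ inj₁ (inject₁ (column s k) , f5-end p s)
    edge-inject₁ s k = cong (edgeAt s) (view-inject₁ k)

    edge-joins : ∀ c → CycleEdge (edge c) × Joins σ d (edge c) (vertex c) (vertex (step c))
    edge-joins (s , k) = go s (view k)
      where
      inject₁≢last : ∀ k → inject₁ k ≢ last
      inject₁≢last k eq = fromℕ≢inject₁ (sym eq)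
      go : ∀ s {k} (v : View k) →
           CycleEdge (edgeAt s v) × Joins σ d (edgeAt s v) (vertex (s , k)) (vertex (stepAt s v))
      go 0F ‵fromℕ       = inj₂ refl , inj₁ (refl , refl)
      go 1F ‵fromℕ       =
        inj₁ σ[opposite-last]≡σ0 , inj₂ (cong (_, f5-end p 0F) σ[opposite-last]≡σ0 , refl)
        where
        σ[opposite-last]≡σ0 : σ (opposite last) ≡ σ zero
        σ[opposite-last]≡σ0 = cong σ (opposite-fromℕ (suc n))
      go 0F (‵inject₁ k) = inject₁≢last k ,
        inj₁ (refl , cong₂ _,_ (cong σ (nextF-inject₁ k)) (+₆-d-identityʳ (inject₁ k) (f5-end p 0F)))
      go 1F (‵inject₁ k) = inject₁≢last (opposite k) ,
        inj₂ (refl , cong₂ _,_ (cong σ (trans (nextF-inject₁ (opposite k)) (sym (opposite-inject₁ k))))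
                               (+₆-d-identityʳ (inject₁ (opposite k)) (f5-end p 1F)))

    vertex-injective : Injective _≡_ _≡_ vertex
    vertex-injective {s , k} {s′ , k′} eq with refl ← f5-end-injectiveʳ p {s} {s′} (cong proj₂ eq) =
      cong (s ,_) (column-injective s (σ-injective (cong proj₁ eq)))

    edge-injective : Injective _≡_ _≡_ edge
    edge-injective {s , k} {s′ , k′} = go (view k) (view k′)
      where
      go : ∀ {k k′} (v : View k) (v′ : View k′) →
           edgeAt s v ≡ edgeAt s′ v′ → (s , k) ≡ (s′ , k′)
      go ‵fromℕ ‵fromℕ eq =
        cong (_, last) (column-fromℕ-injective (σ-injective (cong proj₁ (inj₂-injective eq))))
      go (‵inject₁ k) (‵inject₁ k′) eq
        with refl ← f5-end-injectiveʳ p {s} {s′} (cong proj₂ (inj₁-injective eq)) =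
        cong (λ k → s , inject₁ k)
             (column-injective s (inject₁-injective (cong proj₁ (inj₁-injective eq))))
      go ‵fromℕ (‵inject₁ _) ()
      go (‵inject₁ _) ‵fromℕ ()

    corner-column : ∀ {i} → Corner i → ∃ λ s → i ≡ σ (column s last)
    corner-column (inj₁ i≡σ0)    = 1F , trans i≡σ0 (cong σ (sym (opposite-fromℕ (suc n))))
    corner-column (inj₂ i≡σlast) = 0F , i≡σlast

    edge-closed : ∀ c e → CycleEdge e → Incident σ d e (vertex c) → ∃ λ c′ → e ≡ edge c′
    edge-closed (s , _) (inj₁ (k , j)) inner inc with view k
    ... | ‵fromℕ      = contradiction refl inner
    ... | ‵inject₁ k′ = (s , inject₁ (column s k′)) , (begin
      inj₁ (inject₁ k′ , j)                                ≡⟨ cong₂ (λ k j → inj₁ (inject₁ k , j))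
                                                                    (column-involutive s k′)
                                                                    (proj₁ (incident-column _ j inc)) ⟨
      inj₁ (inject₁ (column s (column s k′)) , f5-end p s) ≡⟨ edge-inject₁ s (column s k′) ⟨
      edge (s , inject₁ (column s k′))                     ∎)
      where open ≡-Reasoning
    edge-closed (s , _) (inj₂ (i , q)) corner inc with corner-column corner
    ... | s′ , i≡σ[column] = (s′ , last) , (begin
      inj₂ (i , q)                   ≡⟨ cong₂ (λ i q → inj₂ (i , q)) i≡σ[column] q≡p ⟩
      inj₂ (σ (column s′ last) , p)  ≡⟨ edge-last s′ ⟨
      edge (s′ , last)               ∎)
      where
      open ≡-Reasoning
      q≡p : q ≡ p
      q≡p = trans (sym (proj₂ (incident-f5 i q inc))) (cong proj₁ (f5⁻¹-end p s))

    cv : Fin (2 * (2 + n)) → Vtx (2 + n)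
    cv = vertex ∘ remQuot₂ (2 + n)

    ce : Fin (2 * (2 + n)) → Lbl (2 + n)
    ce = edge ∘ remQuot₂ (2 + n)

    cv-visits : ∀ v s → ∃ λ i → cv i ≡ (v , f5-end p s)
    cv-visits v s with k , σk≡v ← injective⇒surjective σ-injective v = combine₂ c , (begin
      vertex (remQuot₂ (2 + n) (combine₂ c))  ≡⟨ cong vertex (remQuot₂-combine₂ c) ⟩
      σ (column s (column s k)) , f5-end p s  ≡⟨ cong (λ k → σ k , f5-end p s) (column-involutive s k) ⟩
      σ k , f5-end p s                        ≡⟨ cong (_, f5-end p s) σk≡v ⟩
      v , f5-end p s                          ∎)
      where
      open ≡-Reasoning
      c : Fin 2 × Fin (2 + n)
      c = s , column s k

    cv-joins : ∀ i → colour (ce i) ≡ true × Joins σ d (ce i) (cv i) (cv (nextF i))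
    cv-joins i with cycle-edge , joins ← edge-joins (remQuot₂ (2 + n) i) =
      dec-true (cycleEdge? (ce i)) cycle-edge ,
      subst (Joins σ d (ce i) (cv i) ∘ vertex) (sym (remQuot₂-nextF (suc n) i)) joins

    cv-closed : ∀ e i → colour e ≡ true → Incident σ d e (cv i) → ∃ λ m → e ≡ ce m
    cv-closed e i c inc with c′ , e≡edge ← edge-closed (remQuot₂ (2 + n) i) e (colour-true e c) inc =
      combine₂ c′ , trans e≡edge (cong edge (sym (remQuot₂-combine₂ c′)))

  cycleFactor : IsCycleFactor σ d colour true (2 * (2 + n))
  cycleFactor (v , j) =
    cv , ce ,
    remQuot₂-injective (2 + n) ∘ vertex-injective , remQuot₂-injective (2 + n) ∘ edge-injective ,
    visits , cv-joins , cv-closed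
    where
    open Cycle (pairOf j)
    visits : ∃ λ i → cv i ≡ (v , j)
    visits with i , cv[i]≡ ← cv-visits v (proj₂ (f5⁻¹ j)) =
      i , trans cv[i]≡ (cong (v ,_) (f5-end-f5⁻¹ j))

  decomposition : Decomposes σ d
  decomposition = colour , cycleFactor , oneFactor

-- The bound x ≥ 2 keeps the two f₅-edges of each cycle apart (column-fromℕ-injective).
lemma4 : (x : ℕ) → 2 ≤ x → 2 ∣ x →
    (S : Subset 6) (t : ℕ) → 1 ≤ t → (Σ : Fin t → Z6) (T : Fin t → Fin x → Z6) →
    IsMRSM S t x Σ T →
    (σ : Fin x → Fin x) → Injective _≡_ _≡_ σ →
    (r : Fin t) → (∀ k → T r k ≡ zero) →
    Decomposes σ (T r)
lemma4 (suc (suc n)) (s≤s (s≤s z≤n)) _ _ _ _ _ T _ σ σ-injective r T[r]≡0 =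
  ZeroRow.decomposition σ σ-injective (T r) T[r]≡0
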